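{- Let $b \geq d \geq D \geq 1$ be integers with $b \geq 2$, $d > 1$, and $\beta := b - D \geq 2$, and let $c(x) := c_{b,\beta}(x/d)$ for $x \in \mathbb{Q}_{\geq 0}$. If $d \leq b - 2$ and $b > 6$, then $c(1) \geq \dfrac{\beta+1}{\beta(\beta-1)}$.
   Context: For a base $b \geq 2$, each real $x \geq 0$ has a unique normal base-$b$ expansion $x = \sum_i x_i b^i$ (digits in $\{0,\dots,b-1\}$, $x_i=0$ for $i\gg0$, not ending in infinitely many digits $b-1$). The $(b,\beta)$-content is $c_{b,\beta}(x) := \sum_i x_i \beta^i$. -}

module Defs where

open import Data.Nat as ℕ using (ℕ; zero; suc; _^_)
open import Data.Nat.DivMod using (_/_; _%_)
open import Data.Integer using (+_)
open import Data.Rational as ℚ using (ℚ; 0ℚ; Positive)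
open import Data.Product using (∃-syntax)

-- a / n as a rational, for n ≥ 1 (junk value 0 when n = 0; only used with n ≥ 1)
ratio : ℕ → ℕ → ℚ
ratio a zero    = 0ℚ
ratio a (suc n) = (+ a) ℚ./ suc n

-- Digits of a natural number n in base b (b ≥ 2), read with weights β^i:
-- Σ_{i ≥ 0} n_i β^i.  The fuel k bounds the number of digits; fuel n suffices
-- since n < b^n.
intContentFuel : (b β : ℕ) → ℕ → ℕ → ℕ
intContentFuel b β zero    n = 0
intContentFuel (suc b) β (suc k) n =
  n % suc b ℕ.+ β ℕ.* intContentFuel (suc b) β k (n / suc b)
intContentFuel zero β (suc k) n = 0

intContent : (b β n : ℕ) → ℕ
intContent b β n = intContentFuel b β n n

-- The i-th fractional digit (i ≥ 1, weight b^(-i)) of the normal base-b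
-- expansion of x = p / q  (q ≥ 1):  x_{-i} = ⌊ p b^i / q ⌋ mod b.
fracDigit : (b p q i : ℕ) → ℕ
fracDigit zero    p q i = 0
fracDigit (suc b) p zero i = 0
fracDigit (suc b) p (suc q) i = ((p ℕ.* suc b ^ i) / suc q) % suc b

fracPartial : (b β p q N : ℕ) → ℚ
fracPartial b β p q zero    = 0ℚ
fracPartial b β p q (suc N) =
  fracPartial b β p q N ℚ.+ ratio (fracDigit b p q (suc N)) (β ^ suc N)

contentPartial : (b β p q N : ℕ) → ℚ
contentPartial b β p q N with q
... | zero  = 0ℚ
... | suc q' = ratio (intContent b β (p / suc q')) 1 ℚ.+ fracPartial b β p (suc q') N

-- c_{b,β}(p/q) ≥ r, where c_{b,β}(p/q) = lim_N S_N (a nondecreasing limit,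
-- i.e. the supremum of the partial sums): for every rational ε > 0
-- some partial sum exceeds r - ε.
contentGE : (b β p q : ℕ) → ℚ → Set
contentGE b β p q r =
  ∀ (ε : ℚ) → Positive ε → ∃[ N ] (r ℚ.- ε ℚ.< contentPartial b β p q N)

-- Write b = d + s with s ≥ 2.  Then 1/d = Σ_{i ≥ 0} s^i / b^(i+1), so the leading base-b digit of
-- 1/d is ⌊b/d⌋ and the i-th digit is at least s^(i-1) as long as s^(i-1) < d.  As β = b − D ≥ s,
-- the first three digits alone already give content ≥ (β+1)/(β(β−1)): if d ≤ s the leading digit
-- is ≥ 2; if 3 ≤ s < d the second digit is ≥ 3; and if s = 2, then b > 6 forces d ≥ 5 > s², so the
-- digits are at least 1, 2, 4.
module Submission where

open import Defs
open import Data.Nat using (ℕ; _+_; _*_; _∸_; _≤_; _<_; _≥_; _>_)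
open import Relation.Binary.PropositionalEquality using (_≡_)

open import Data.Nat using (zero; suc; _^_; z≤n; s≤s; NonZero)
open import Data.Nat.DivMod
open import Data.Nat.Properties
open import Data.Nat.Solver using (module +-*-Solver)
open +-*-Solver using (solve; _:+_; _:*_; _:^_; _:=_; con)
open import Data.Nat.Tactic.RingSolver using (solve-∀)
open import Data.Integer as ℤ using (+_)
import Data.Integer.Properties as ℤ
open import Data.Rational as ℚ using (0ℚ; toℚᵘ; fromℚᵘ)
import Data.Rational.Properties as ℚ
open import Data.Rational.Unnormalised as ℚᵘ using (mkℚᵘ; *≡*; *≤*)
import Data.Rational.Unnormalised.Properties as ℚᵘ
open import Data.Product using (_,_)
open import Relation.Binary.PropositionalEquality
  using (refl; sym; trans; cong; cong₂; subst; subst₂; module ≡-Reasoning)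
open import Relation.Nullary using (yes; no)

private
  variable
    a c m n : ℕ

fromℚᵘ-homo-+ : ∀ p q → fromℚᵘ (p ℚᵘ.+ q) ≡ fromℚᵘ p ℚ.+ fromℚᵘ q
fromℚᵘ-homo-+ p q = ℚ.toℚᵘ-injective (begin
  toℚᵘ (fromℚᵘ (p ℚᵘ.+ q))              ≈⟨ ℚ.toℚᵘ-fromℚᵘ (p ℚᵘ.+ q) ⟩
  p ℚᵘ.+ q
    ≈⟨ ℚᵘ.+-cong (ℚᵘ.≃-sym (ℚ.toℚᵘ-fromℚᵘ p)) (ℚᵘ.≃-sym (ℚ.toℚᵘ-fromℚᵘ q)) ⟩
  toℚᵘ (fromℚᵘ p) ℚᵘ.+ toℚᵘ (fromℚᵘ q)  ≈⟨ ℚᵘ.≃-sym (ℚ.toℚᵘ-homo-+ (fromℚᵘ p) (fromℚᵘ q)) ⟩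
  toℚᵘ (fromℚᵘ p ℚ.+ fromℚᵘ q)          ∎)
  where open ℚᵘ.≃-Reasoning

-- ratio a (suc m) unfolds to fromℚᵘ (mkℚᵘ (+ a) m), which the proofs below exploit.
ratio-cong : .{{_ : NonZero m}} .{{_ : NonZero n}} → a * n ≡ c * m → ratio a m ≡ ratio c n
ratio-cong {suc m} {suc n} {a} {c} eq = ℚ.fromℚᵘ-cong {mkℚᵘ (+ a) m} {mkℚᵘ (+ c) n} (*≡* (begin
  + a ℤ.* + suc n   ≡⟨ ℤ.pos-* a (suc n) ⟨
  + (a * suc n)     ≡⟨ cong +_ eq ⟩
  + (c * suc m)     ≡⟨ ℤ.pos-* c (suc m) ⟩
  + c ℤ.* + suc m   ∎))
  where open ≡-Reasoning

ratio-mono-≤ : .{{_ : NonZero m}} .{{_ : NonZero n}} → a * n ≤ c * m → ratio a m ℚ.≤ ratio c n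
ratio-mono-≤ {suc m} {suc n} {a} {c} le = ℚ.toℚᵘ-cancel-≤
  (ℚᵘ.≤-respˡ-≃ (ℚᵘ.≃-sym (ℚ.toℚᵘ-fromℚᵘ (mkℚᵘ (+ a) m)))
  (ℚᵘ.≤-respʳ-≃ (ℚᵘ.≃-sym (ℚ.toℚᵘ-fromℚᵘ (mkℚᵘ (+ c) n)))
  (*≤* (subst₂ ℤ._≤_ (ℤ.pos-* a (suc n)) (ℤ.pos-* c (suc m)) (ℤ.+≤+ le)))))

ratio-+ : .{{_ : NonZero m}} .{{_ : NonZero n}} →
          ratio a m ℚ.+ ratio c n ≡ ratio (a * n + c * m) (m * n)
ratio-+ {suc m} {suc n} {a} {c} = begin
  ratio a (suc m) ℚ.+ ratio c (suc n)      ≡⟨ fromℚᵘ-homo-+ (mkℚᵘ (+ a) m) (mkℚᵘ (+ c) n) ⟨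
  fromℚᵘ (mkℚᵘ (+ a) m ℚᵘ.+ mkℚᵘ (+ c) n)  ≡⟨ cong (λ z → fromℚᵘ (mkℚᵘ z _)) numerator ⟩
  ratio (a * suc n + c * suc m) (suc m * suc n) ∎
  where
  open ≡-Reasoning
  numerator : + a ℤ.* + suc n ℤ.+ + c ℤ.* + suc m ≡ + (a * suc n + c * suc m)
  numerator = trans (cong₂ ℤ._+_ (sym (ℤ.pos-* a (suc n))) (sym (ℤ.pos-* c (suc m))))
                    (sym (ℤ.pos-+ (a * suc n) (c * suc m)))

ratio-nonNeg : ∀ a m → 0ℚ ℚ.≤ ratio a m
ratio-nonNeg a zero    = ℚ.≤-refl
ratio-nonNeg a (suc m) = ℚ.nonNegative⁻¹ (ratio a (suc m)) {{ℚ.normalize-nonNeg a (suc m)}}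

fracNumerator : (b β p q N : ℕ) → ℕ
fracNumerator b β p q zero    = 0
fracNumerator b β p q (suc N) = fracNumerator b β p q N * β + fracDigit b p q (suc N)

fracPartial≡ratio : ∀ b β p q N .{{_ : NonZero β}} →
                    fracPartial b β p q N ≡ ratio (fracNumerator b β p q N) (β ^ N)
fracPartial≡ratio b β p q zero    = refl
fracPartial≡ratio b β p q (suc N) = begin
  fracPartial b β p q N ℚ.+ ratio x (β * B)  ≡⟨ cong (ℚ._+ ratio x (β * B)) (fracPartial≡ratio b β p q N) ⟩
  ratio k B ℚ.+ ratio x (β * B)              ≡⟨ ratio-+ {m = B} {n = β * B} {a = k} {c = x} ⟩
  ratio (k * (β * B) + x * B) (B * (β * B))  ≡⟨ ratio-cong {{m*n≢0 B (β * B)}} (cross k x β B) ⟩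
  ratio (k * β + x) (β * B)                  ∎
  where
  open ≡-Reasoning
  B k x : ℕ
  B = β ^ N
  k = fracNumerator b β p q N
  x = fracDigit b p q (suc N)
  instance
    B≢0 : NonZero B
    B≢0 = m^n≢0 β N
    βB≢0 : NonZero (β * B)
    βB≢0 = m*n≢0 β B
  cross : ∀ k x β B → (k * (β * B) + x * B) * (β * B) ≡ (k * β + x) * (B * (β * B))
  cross = solve-∀

contentGE-of-fracNumerator : ∀ {b β p q r m} N .{{_ : NonZero β}} .{{_ : NonZero q}} .{{_ : NonZero m}} →
  r * β ^ N ≤ fracNumerator b β p q N * m → contentGE b β p q (ratio r m)
contentGE-of-fracNumerator {b} {β} {p} {suc q} {r} {m} N le ε ε>0 = N , (begin-strict
  ratio r m ℚ.- ε
    <⟨ ℚ.+-monoʳ-< (ratio r m) (ℚ.neg-antimono-< (ℚ.positive⁻¹ ε {{ε>0}})) ⟩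
  ratio r m ℚ.+ ℚ.- 0ℚ                              ≡⟨ ℚ.+-identityʳ (ratio r m) ⟩
  ratio r m                                        ≤⟨ ratio-mono-≤ le ⟩
  ratio (fracNumerator b β p (suc q) N) (β ^ N)    ≡⟨ fracPartial≡ratio b β p (suc q) N ⟨
  fracPartial b β p (suc q) N                      ≡⟨ ℚ.+-identityˡ (fracPartial b β p (suc q) N) ⟨
  0ℚ ℚ.+ fracPartial b β p (suc q) N
    ≤⟨ ℚ.+-monoˡ-≤ (fracPartial b β p (suc q) N) (ratio-nonNeg (intContent b β (p / suc q)) 1) ⟩
  contentPartial b β p (suc q) N                   ∎)
  where
  open ℚ.≤-Reasoning
  instance
    βᴺ≢0 : NonZero (β ^ N)
    βᴺ≢0 = m^n≢0 β N

m*n≤o⇒m≤o/n : ∀ m n o .{{_ : NonZero n}} → m * n ≤ o → m ≤ o / n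
m*n≤o⇒m≤o/n m n o le = subst (_≤ o / n) (m*n/n≡m m n) (/-monoˡ-≤ n le)

fracDigit≡quotient : ∀ {b p q} i k u .{{_ : NonZero b}} .{{_ : NonZero q}} →
                     u < b * q → p * b ^ i ≡ u + k * (b * q) → fracDigit b p q i ≡ u / q
fracDigit≡quotient {suc b} {p} {suc q} i k u u<bq eq = begin
  p * suc b ^ i / suc q % suc b                  ≡⟨ m%[n*o]/o≡m/o%n (p * suc b ^ i) (suc b) (suc q) ⟨
  p * suc b ^ i % (suc b * suc q) / suc q        ≡⟨ /-congˡ (%-congˡ eq) ⟩
  (u + k * (suc b * suc q)) % (suc b * suc q) / suc q ≡⟨ /-congˡ ([m+kn]%n≡m%n u k (suc b * suc q)) ⟩
  u % (suc b * suc q) / suc q                    ≡⟨ /-congˡ (m<n⇒m%n≡m u<bq) ⟩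
  u / suc q                                      ∎
  where open ≡-Reasoning

reciprocalDigit-≥ : ∀ {b d} i j c k .{{_ : NonZero b}} .{{_ : NonZero d}} →
                    c < d → j * d ≤ b * c → 1 * b ^ i ≡ b * c + k * (b * d) → j ≤ fracDigit b 1 d i
reciprocalDigit-≥ {b} {d} i j c k c<d jd≤bc eq =
  subst (j ≤_) (sym (fracDigit≡quotient i k (b * c) (*-monoʳ-< b c<d) eq)) (m*n≤o⇒m≤o/n j d (b * c) jd≤bc)

leadingDigit-≥ : ∀ d s j .{{_ : NonZero d}} → 1 < d → j * d ≤ d + s → j ≤ fracDigit (d + s) 1 d 1
leadingDigit-≥ d@(suc _) s j 1<d jd≤b =
  reciprocalDigit-≥ 1 j 1 0 1<d (subst (j * d ≤_) (sym (*-identityʳ (d + s))) jd≤b) (expansion d s)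
  where
  expansion : ∀ d s → 1 * (d + s) ^ 1 ≡ (d + s) * 1 + 0 * ((d + s) * d)
  expansion = solve 2 (λ d s → con 1 :* (d :+ s) :^ 1 := (d :+ s) :* con 1 :+ con 0 :* ((d :+ s) :* d)) refl

secondDigit-≥ : ∀ d s .{{_ : NonZero d}} → s < d → s ≤ fracDigit (d + s) 1 d 2
secondDigit-≥ d@(suc _) s s<d =
  reciprocalDigit-≥ 2 s s 1 s<d (subst (_≤ (d + s) * s) (*-comm d s) (*-monoˡ-≤ s (m≤m+n d s))) (expansion d s)
  where
  expansion : ∀ d s → 1 * (d + s) ^ 2 ≡ (d + s) * s + 1 * ((d + s) * d)
  expansion = solve 2 (λ d s → con 1 :* (d :+ s) :^ 2 := (d :+ s) :* s :+ con 1 :* ((d :+ s) :* d)) refl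

thirdDigit-≥ : ∀ d s .{{_ : NonZero d}} → s * s < d → s * s ≤ fracDigit (d + s) 1 d 3
thirdDigit-≥ d@(suc _) s s²<d =
  reciprocalDigit-≥ 3 (s * s) (s * s) (d + s + s) s²<d
    (subst (_≤ (d + s) * (s * s)) (*-comm d (s * s)) (*-monoˡ-≤ (s * s) (m≤m+n d s))) (expansion d s)
  where
  expansion : ∀ d s → 1 * (d + s) ^ 3 ≡ (d + s) * (s * s) + (d + s + s) * ((d + s) * d)
  expansion = solve 2 (λ d s → con 1 :* (d :+ s) :^ 3
                             := (d :+ s) :* (s :* s) :+ (d :+ s :+ s) :* ((d :+ s) :* d)) refl

-- (β + 1) / (β (β − 1)) ≤ a₁/β + a₂/β² + a₃/β³, with the denominators cleared.
ThreeDigitBound : (β a₁ a₂ a₃ : ℕ) → Set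
ThreeDigitBound β a₁ a₂ a₃ = (β + 1) * β ^ 3 ≤ ((a₁ * β + a₂) * β + a₃) * (β * (β ∸ 1))

horner-mono-≤ : ∀ β {a₁ a₂ a₃ c₁ c₂ c₃} → a₁ ≤ c₁ → a₂ ≤ c₂ → a₃ ≤ c₃ →
                (a₁ * β + a₂) * β + a₃ ≤ (c₁ * β + c₂) * β + c₃
horner-mono-≤ β a₁≤c₁ a₂≤c₂ a₃≤c₃ =
  +-mono-≤ (*-monoˡ-≤ β (+-mono-≤ (*-monoˡ-≤ β a₁≤c₁) a₂≤c₂)) a₃≤c₃

threeDigitBound-a₁≥2 : ∀ {β a₁ a₂ a₃} → 3 ≤ β → 2 ≤ a₁ → ThreeDigitBound β a₁ a₂ a₃
threeDigitBound-a₁≥2 {β@(suc (suc (suc k)))} {a₁} {a₂} {a₃} (s≤s (s≤s (s≤s _))) 2≤a₁ = begin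
  (β + 1) * β ^ 3                             ≤⟨ m≤m+n _ (k * β ^ 3) ⟩
  (β + 1) * β ^ 3 + k * β ^ 3                 ≡⟨ identity ⟩
  ((2 * β + 0) * β + 0) * (β * (2 + k))       ≤⟨ *-monoˡ-≤ (β * (2 + k)) (horner-mono-≤ β 2≤a₁ z≤n z≤n) ⟩
  ((a₁ * β + a₂) * β + a₃) * (β * (β ∸ 1))    ∎
  where
  open ≤-Reasoning
  identity : (β + 1) * β ^ 3 + k * β ^ 3 ≡ ((2 * β + 0) * β + 0) * (β * (2 + k))
  identity = solve 1 (λ k → (con 3 :+ k :+ con 1) :* (con 3 :+ k) :^ 3 :+ k :* (con 3 :+ k) :^ 3
                         := ((con 2 :* (con 3 :+ k) :+ con 0) :* (con 3 :+ k) :+ con 0)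
                            :* ((con 3 :+ k) :* (con 2 :+ k))) refl k

threeDigitBound-a₂≥3 : ∀ {β a₁ a₂ a₃} → 3 ≤ β → 1 ≤ a₁ → 3 ≤ a₂ → ThreeDigitBound β a₁ a₂ a₃
threeDigitBound-a₂≥3 {β@(suc (suc (suc k)))} {a₁} {a₂} {a₃} (s≤s (s≤s (s≤s _))) 1≤a₁ 3≤a₂ = begin
  (β + 1) * β ^ 3                             ≤⟨ m≤m+n _ (k * β * β) ⟩
  (β + 1) * β ^ 3 + k * β * β                 ≡⟨ identity ⟩
  ((1 * β + 3) * β + 0) * (β * (2 + k))       ≤⟨ *-monoˡ-≤ (β * (2 + k)) (horner-mono-≤ β 1≤a₁ 3≤a₂ z≤n) ⟩
  ((a₁ * β + a₂) * β + a₃) * (β * (β ∸ 1))    ∎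
  where
  open ≤-Reasoning
  identity : (β + 1) * β ^ 3 + k * β * β ≡ ((1 * β + 3) * β + 0) * (β * (2 + k))
  identity = solve 1 (λ k → (con 3 :+ k :+ con 1) :* (con 3 :+ k) :^ 3 :+ k :* (con 3 :+ k) :* (con 3 :+ k)
                         := ((con 1 :* (con 3 :+ k) :+ con 3) :* (con 3 :+ k) :+ con 0)
                            :* ((con 3 :+ k) :* (con 2 :+ k))) refl k

threeDigitBound-1-2-4 : ∀ {β a₁ a₂ a₃} → 2 ≤ β → 1 ≤ a₁ → 2 ≤ a₂ → 4 ≤ a₃ → ThreeDigitBound β a₁ a₂ a₃
threeDigitBound-1-2-4 {β@(suc (suc k))} {a₁} {a₂} {a₃} (s≤s (s≤s _)) 1≤a₁ 2≤a₂ 4≤a₃ = begin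
  (β + 1) * β ^ 3                             ≤⟨ m≤m+n _ (2 * k * β) ⟩
  (β + 1) * β ^ 3 + 2 * k * β                 ≡⟨ identity ⟩
  ((1 * β + 2) * β + 4) * (β * (1 + k))       ≤⟨ *-monoˡ-≤ (β * (1 + k)) (horner-mono-≤ β 1≤a₁ 2≤a₂ 4≤a₃) ⟩
  ((a₁ * β + a₂) * β + a₃) * (β * (β ∸ 1))    ∎
  where
  open ≤-Reasoning
  identity : (β + 1) * β ^ 3 + 2 * k * β ≡ ((1 * β + 2) * β + 4) * (β * (1 + k))
  identity = solve 1 (λ k → (con 2 :+ k :+ con 1) :* (con 2 :+ k) :^ 3 :+ con 2 :* k :* (con 2 :+ k)
                         := ((con 1 :* (con 2 :+ k) :+ con 2) :* (con 2 :+ k) :+ con 4)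
                            :* ((con 2 :+ k) :* (con 1 :+ k))) refl k

reciprocal-threeDigitBound : ∀ d s β .{{_ : NonZero d}} → 1 < d → 2 ≤ s → 7 ≤ d + s → s ≤ β → 2 ≤ β →
  ThreeDigitBound β (fracDigit (d + s) 1 d 1) (fracDigit (d + s) 1 d 2) (fracDigit (d + s) 1 d 3)
reciprocal-threeDigitBound d 1 β _ (s≤s ()) _ _ _
reciprocal-threeDigitBound d 2 β 1<d _ 7≤b _ 2≤β =
  threeDigitBound-1-2-4 2≤β (leadingDigit-≥ d 2 1 1<d (+-monoʳ-≤ d z≤n))
                            (secondDigit-≥ d 2 (≤-trans (s≤s (s≤s (s≤s z≤n))) 5≤d))
                            (thirdDigit-≥ d 2 5≤d)
  where
  5≤d : 5 ≤ d
  5≤d = +-cancelʳ-≤ 2 5 d 7≤b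
reciprocal-threeDigitBound d s@(suc (suc (suc _))) β 1<d _ _ s≤β _
  with d ≤? s | ≤-trans (s≤s (s≤s (s≤s z≤n))) s≤β
... | yes d≤s | 3≤β = threeDigitBound-a₁≥2 3≤β
                        (leadingDigit-≥ d s 2 1<d (+-monoʳ-≤ d (≤-trans (≤-reflexive (+-identityʳ d)) d≤s)))
... | no  d≰s | 3≤β = threeDigitBound-a₂≥3 3≤β (leadingDigit-≥ d s 1 1<d (+-monoʳ-≤ d z≤n))
                        (≤-trans (s≤s (s≤s (s≤s z≤n))) (secondDigit-≥ d s (≰⇒> d≰s)))

reciprocal-contentGE : ∀ d s β → 1 < d → 2 ≤ s → 7 ≤ d + s → s ≤ β → 2 ≤ β →
                       contentGE (d + s) β 1 d (ratio (β + 1) (β * (β ∸ 1)))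
reciprocal-contentGE d@(suc _) s β@(suc (suc _)) 1<d 2≤s 7≤b s≤β 2≤β@(s≤s (s≤s _)) =
  contentGE-of-fracNumerator {d + s} {β} {1} {d} 3 (reciprocal-threeDigitBound d s β 1<d 2≤s 7≤b s≤β 2≤β)

proposition8p8 : (b d D β : ℕ) → b ≥ d → d ≥ D → D ≥ 1 → b ≥ 2 → d > 1
    → β ≡ b ∸ D → β ≥ 2 → d ≤ b ∸ 2 → b > 6
    → contentGE b β 1 d (ratio (β + 1) (β * (β ∸ 1)))
proposition8p8 b d D β b≥d d≥D _ b≥2 d>1 β≡b∸D β≥2 d≤b∸2 b>6 with m≤n⇒∃[o]m+o≡n b≥d
... | s , refl = reciprocal-contentGE d s β d>1 2≤s b>6 s≤β β≥2
  where
  2≤s : 2 ≤ s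
  2≤s = +-cancelˡ-≤ d 2 s (m≤o∸n⇒m+n≤o d b≥2 d≤b∸2)
  s≤β : s ≤ β
  s≤β = subst₂ _≤_ (m+n∸m≡n d s) (sym β≡b∸D) (∸-monoʳ-≤ (d + s) d≥D)
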